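{- Every DI-sortable permutation is sorted by the algorithm described below; that is, the algorithm is optimal for sorting permutations with the DI machine. The algorithm repeatedly performs the first applicable of the following rules: (1) if the top entry of I is the next entry to be output, move it to the output; (2) if the $m$ entries currently in D are exactly the next $m$ entries to be output, move them (one at a time, from the top of D) to I; (3) otherwise, if the next entry of the input is smaller than the top entry of I (or I is empty) and larger than the top entry of D (or D is empty), push it onto D; (4) otherwise, move the top entry of D to I.
   Context: The DI machine consists of two stacks in series: a decreasing stack D followed by an increasing stack I. A permutation $\pi=\pi(1)\cdots\pi(n)$ is processed from left to right, and the allowed moves are: push the next unread input entry onto the top of D; move the top entry of D onto the top of I; move the top entry of I to the end of the output. The entries of D must be decreasing when read from top to bottom (an entry may be placed on D only if it exceeds D's current top entry, or D is empty), and the entries of I must be increasing when read from top to bottom (an entry may be placed on I only if it is smaller than I's current top entry, or I is empty). A permutation $\pi$ of length $n$ is DI-sortable if some sequence of legal moves empties the input and both stacks and produces the output $12\cdots n$. -}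

module Defs where

open import Data.Nat using (ℕ; zero; suc; _+_; _<_; _<ᵇ_; _≡ᵇ_)
open import Data.Bool using (Bool; true; false; _∧_; if_then_else_)
open import Data.List using (List; []; _∷_; _++_; [_]; map; upTo; length)
open import Data.Bool.ListAction using (all; any)
open import Data.Maybe using (Maybe; just; nothing)
open import Data.Product using (_×_; _,_)
open import Relation.Binary.PropositionalEquality using (_≡_)
open import Relation.Binary.Construct.Closure.ReflexiveTransitive using (Star)
open import Data.List.Relation.Binary.Permutation.Propositional using (_↭_)

idList : ℕ → List ℕ
idList n = map suc (upTo n)

IsPerm : List ℕ → Set
IsPerm π = π ↭ idList (length π)

-- A configuration of the DI machine.
-- inp : the unread input (next entry first)
-- D   : the decreasing stack, listed from top to bottom
-- I   : the increasing stack, listed from top to bottom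
-- out : the output produced so far, in order
record Config : Set where
  constructor cfg
  field
    inp : List ℕ
    D   : List ℕ
    I   : List ℕ
    out : List ℕ

CanPushD : ℕ → List ℕ → Set
CanPushD x []      = Data.Unit.⊤ where import Data.Unit
CanPushD x (t ∷ _) = t < x

CanPushI : ℕ → List ℕ → Set
CanPushI x []      = Data.Unit.⊤ where import Data.Unit
CanPushI x (t ∷ _) = x < t

data Move : Config → Config → Set where
  push  : ∀ {x inp D I out} → CanPushD x D →
          Move (cfg (x ∷ inp) D I out) (cfg inp (x ∷ D) I out)
  dToI  : ∀ {x inp D I out} → CanPushI x I →
          Move (cfg inp (x ∷ D) I out) (cfg inp D (x ∷ I) out)
  emit  : ∀ {x inp D I out} →
          Move (cfg inp D (x ∷ I) out) (cfg inp D I (out ++ [ x ]))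

initial : List ℕ → Config
initial π = cfg π [] [] []

final : ℕ → Config
final n = cfg [] [] [] (idList n)

DISortable : List ℕ → Set
DISortable π = Star Move (initial π) (final (length π))

canPushDᵇ : ℕ → List ℕ → Bool
canPushDᵇ x []      = true
canPushDᵇ x (t ∷ _) = t <ᵇ x

canPushIᵇ : ℕ → List ℕ → Bool
canPushIᵇ x []      = true
canPushIᵇ x (t ∷ _) = x <ᵇ t

nextBlock : ℕ → ℕ → List ℕ
nextBlock k m = map (λ j → k + suc j) (upTo m)

elemᵇ : ℕ → List ℕ → Bool
elemᵇ x ys = any (λ y → x ≡ᵇ y) ys

-- "the m entries of D are exactly the next m entries to be output",
-- where k entries have been output so far (so the next ones are k+1, k+2, ...);
-- D is required to be nonempty (m ≥ 1).
dIsNextBlock : ℕ → List ℕ → Bool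
dIsNextBlock k []        = false
dIsNextBlock k D@(_ ∷ _) =
  all (λ j → elemᵇ j D) (nextBlock k (length D))
  ∧ all (λ x → elemᵇ x (nextBlock k (length D))) D

moveAll : List ℕ → List ℕ → Maybe (List ℕ)
moveAll []      I = just I
moveAll (x ∷ D) I = if canPushIᵇ x I then moveAll D (x ∷ I) else nothing

-- One macro-step of the algorithm: apply the first applicable rule.
-- Returns nothing when no rule applies or the prescribed move is illegal
-- (in particular at the terminal configuration).

rule4 : List ℕ → List ℕ → List ℕ → List ℕ → Maybe Config
rule4 inp []       I out = nothing
rule4 inp (x ∷ D') I out =
  if canPushIᵇ x I then just (cfg inp D' (x ∷ I) out) else nothing

rule3 : List ℕ → List ℕ → List ℕ → List ℕ → Maybe Config
rule3 []         D I out = rule4 [] D I out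
rule3 (x ∷ inp') D I out =
  if canPushIᵇ x I ∧ canPushDᵇ x D
  then just (cfg inp' (x ∷ D) I out) else rule4 (x ∷ inp') D I out

rule2 : List ℕ → List ℕ → List ℕ → List ℕ → Maybe Config
rule2 inp D I out with dIsNextBlock (length out) D
... | false = rule3 inp D I out
... | true with moveAll D I
...   | nothing = nothing
...   | just I' = just (cfg inp [] I' out)

rule1 : List ℕ → List ℕ → List ℕ → List ℕ → Maybe Config
rule1 inp D []       out = rule2 inp D [] out
rule1 inp D (t ∷ I') out =
  if t ≡ᵇ suc (length out) then just (cfg inp D I' (out ++ [ t ]))
  else rule2 inp D (t ∷ I') out

algStep : Config → Maybe Config
algStep (cfg inp D I out) = rule1 inp D I out

AlgStep : Config → Config → Set
AlgStep c c' = algStep c ≡ just c'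

AlgSorts : List ℕ → Set
AlgSorts π = Star AlgStep (initial π) (final (length π))

module Submission where

-- Call a configuration sortable when some sequence of legal moves finishes the sort.  The
-- heart of the proof is that one step of the algorithm is safe: from a sortable, non-final
-- configuration it makes at least one legal move and reaches a sortable configuration.
-- Sortable configurations output 1, 2, ... in order (Consistent); reachable ones have
-- monotone stacks (Monotone).  Safety is shown rule by rule: rule (1) by moving the output
-- of k+1 to the front of any sort (output-first), rule (2) by an exchange argument showing
-- that a block k+1..B sitting in D can be output before anything else (block-first), and
-- rules (3) and (4) by showing that any other first move creates a jam (Jammed), which no
-- sequence of moves can undo.  Since each move lowers the number of moves still needed,
-- iterating safe steps from the initial configuration reaches the final one.

open import Defs
open import Data.List using (List)
open import Data.Nat using (ℕ)

open import Data.Nat using (zero; suc; _+_; _*_; _∸_; _≤_; _<_; _>_; s≤s; z<s; _≡ᵇ_)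
open import Data.Nat.Properties
open import Data.Nat.Tactic.RingSolver using (solve-∀)
open import Data.Nat.Induction using (<-wellFounded)
open import Induction.WellFounded using (Acc; acc)
open import Data.Bool using (true; false; _∧_; T)
open import Data.Bool.Properties using (T-≡; T-∧; ∧-conicalˡ; ∧-conicalʳ)
open import Data.List using ([]; _∷_; _++_; [_]; map; upTo; applyUpTo; length; _ʳ++_; _∷ʳ_)
import Data.List.Properties as List
open import Data.Bool.ListAction using (all)
open import Data.Product using (_×_; _,_; proj₁; proj₂; ∃-syntax)
open import Data.Sum using (_⊎_; inj₁; inj₂)
open import Data.Maybe using (Maybe; just)
open import Data.Empty using (⊥; ⊥-elim)
open import Data.Unit using (tt)
open import Function.Bundles using (Equivalence)
open import Relation.Nullary using (¬_; yes; no)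
open import Relation.Binary.PropositionalEquality hiding ([_])
open import Relation.Binary.Construct.Closure.ReflexiveTransitive using (Star; ε; _◅_; _◅◅_)
open import Data.List.Membership.Propositional using (_∈_; _∉_; find)
open import Data.List.Membership.Propositional.Properties using (∈-++⁺ˡ; ∈-++⁺ʳ; ∈-++⁻)
open import Data.List.Membership.DecPropositional _≟_ using (_∈?_)
open import Data.List.Relation.Binary.Subset.Propositional using (_⊆_)
open import Data.List.Relation.Unary.Any as Any using (here; there)
open import Data.List.Relation.Unary.Any.Properties using (any⁺; any⁻)
open import Data.List.Relation.Unary.All as All using (All; []; _∷_; all?)
open import Data.List.Relation.Unary.All.Properties using (all⁺; all⁻; ¬All⇒Any¬)
open import Data.List.Relation.Unary.AllPairs as AllPairs using (AllPairs; []; _∷_)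
open import Data.List.Relation.Unary.Unique.Propositional using (Unique)
open import Data.List.Relation.Binary.Permutation.Propositional using (_↭_; ↭-refl; ↭-sym; ↭-trans; ↭⇒↭ₛ; prep)
open import Data.List.Relation.Binary.Permutation.Propositional.Properties using (∈-resp-↭; shift; ++⁺ˡ)
import Data.List.Relation.Binary.Permutation.Setoid.Properties as PermutationSetoid
open import Function using (_∘′_)

-- Ranges of consecutive values.  The output 1..k, the block k+1..k+m examined by rule (2)
-- and the entries k+1..n still to be output are all ranges.

range : ℕ → ℕ → List ℕ
range k zero    = []
range k (suc m) = suc k ∷ range (suc k) m

∈-range⁻ : ∀ k m {j} → j ∈ range k m → k < j × j ≤ k + m
∈-range⁻ k (suc m) (here refl) = ≤-refl , subst (suc k ≤_) (sym (+-suc k m)) (s≤s (m≤m+n k m))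
∈-range⁻ k (suc m) {j} (there j∈) =
  let k+1<j , j≤ = ∈-range⁻ (suc k) m j∈
  in <-trans (n<1+n k) k+1<j , subst (j ≤_) (sym (+-suc k m)) j≤

∈-range⁺ : ∀ k m {j} → k < j → j ≤ k + m → j ∈ range k m
∈-range⁺ k zero {j} k<j j≤k+0 = ⊥-elim (<⇒≱ k<j (subst (j ≤_) (+-identityʳ k) j≤k+0))
∈-range⁺ k (suc m) {j} k<j j≤ with j ≟ suc k
... | yes refl = here refl
... | no j≢1+k =
  there (∈-range⁺ (suc k) m (≤∧≢⇒< k<j (j≢1+k ∘′ sym)) (subst (j ≤_) (+-suc k m) j≤))

range-increasing : ∀ k m → AllPairs _<_ (range k m)
range-increasing k zero    = []
range-increasing k (suc m) =
  All.tabulate (λ j∈ → proj₁ (∈-range⁻ (suc k) m j∈)) ∷ range-increasing (suc k) m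

range-unique : ∀ k m → Unique (range k m)
range-unique k m = AllPairs.map <⇒≢ (range-increasing k m)

unique-resp-↭ : ∀ {xs ys : List ℕ} → xs ↭ ys → Unique xs → Unique ys
unique-resp-↭ xs↭ys = PermutationSetoid.Unique-resp-↭ (setoid ℕ) (↭⇒↭ₛ xs↭ys)

range-∷ʳ : ∀ k m → range k (suc m) ≡ range k m ∷ʳ (k + suc m)
range-∷ʳ k zero    = cong [_] (sym (trans (+-suc k 0) (cong suc (+-identityʳ k))))
range-∷ʳ k (suc m) =
  cong (suc k ∷_) (trans (range-∷ʳ (suc k) m) (cong (range (suc k) m ∷ʳ_) (sym (+-suc k (suc m)))))

applyUpTo-range : ∀ (f : ℕ → ℕ) k m → (∀ j → f j ≡ k + suc j) → applyUpTo f m ≡ range k m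
applyUpTo-range f k zero    f≡ = refl
applyUpTo-range f k (suc m) f≡ =
  cong₂ _∷_ (trans (f≡ 0) (+-comm k 1))
            (applyUpTo-range (λ j → f (suc j)) (suc k) m (λ j → trans (f≡ (suc j)) (+-suc k (suc j))))

nextBlock≡range : ∀ k m → nextBlock k m ≡ range k m
nextBlock≡range k m = trans (List.map-upTo (λ j → k + suc j) m) (applyUpTo-range _ k m (λ _ → refl))

idList-∷ʳ : ∀ n → idList (suc n) ≡ idList n ∷ʳ suc n
idList-∷ʳ n = trans (cong (map suc) (sym (List.upTo-∷ʳ n))) (List.map-++ suc (upTo n) [ n ])

length-idList : ∀ n → length (idList n) ≡ n
length-idList n = trans (List.length-map suc (upTo n)) (List.length-upTo n)

length-∷ʳ : ∀ (xs : List ℕ) x → length (xs ∷ʳ x) ≡ suc (length xs)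
length-∷ʳ xs x = trans (List.length-++ xs) (+-comm (length xs) 1)

true⇒T : ∀ {b} → b ≡ true → T b
true⇒T = Equivalence.from T-≡

T⇒true : ∀ {b} → T b → b ≡ true
T⇒true = Equivalence.to T-≡

canPushIᵇ-sound : ∀ {x} I → canPushIᵇ x I ≡ true → CanPushI x I
canPushIᵇ-sound []      _ = tt
canPushIᵇ-sound (t ∷ _) e = <ᵇ⇒< _ t (true⇒T e)

canPushIᵇ-complete : ∀ {x} I → CanPushI x I → canPushIᵇ x I ≡ true
canPushIᵇ-complete []      _   = refl
canPushIᵇ-complete (t ∷ _) x<t = T⇒true (<⇒<ᵇ x<t)

canPushDᵇ-sound : ∀ {x} D → canPushDᵇ x D ≡ true → CanPushD x D
canPushDᵇ-sound []      _ = tt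
canPushDᵇ-sound (t ∷ _) e = <ᵇ⇒< t _ (true⇒T e)

canPushDᵇ-complete : ∀ {x} D → CanPushD x D → canPushDᵇ x D ≡ true
canPushDᵇ-complete []      _   = refl
canPushDᵇ-complete (t ∷ _) t<x = T⇒true (<⇒<ᵇ t<x)

elemᵇ-sound : ∀ {x} ys → T (elemᵇ x ys) → x ∈ ys
elemᵇ-sound {x} ys e = Any.map (≡ᵇ⇒≡ x _) (any⁻ _ ys e)

elemᵇ-complete : ∀ {x} ys → x ∈ ys → T (elemᵇ x ys)
elemᵇ-complete {x} ys x∈ = any⁺ _ (Any.map (≡⇒≡ᵇ x _) x∈)

subsetᵇ-sound : ∀ xs ys → T (all (λ x → elemᵇ x ys) xs) → xs ⊆ ys
subsetᵇ-sound xs ys e x∈ = elemᵇ-sound ys (All.lookup (all⁺ _ xs e) x∈)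

subsetᵇ-complete : ∀ xs ys → xs ⊆ ys → T (all (λ x → elemᵇ x ys) xs)
subsetᵇ-complete xs ys xs⊆ys = all⁻ _ (All.tabulate (λ x∈ → elemᵇ-complete ys (xs⊆ys x∈)))

IsNextBlock : ℕ → List ℕ → Set
IsNextBlock k D = D ⊆ range k (length D) × range k (length D) ⊆ D

dIsNextBlock-sound : ∀ k d D → T (dIsNextBlock k (d ∷ D)) → IsNextBlock k (d ∷ D)
dIsNextBlock-sound k d D e =
  let block = nextBlock k (length (d ∷ D))
      block⊆D , D⊆block = Equivalence.to (T-∧ {all (λ j → elemᵇ j (d ∷ D)) block}) e
  in  subst ((d ∷ D) ⊆_) (nextBlock≡range k _) (subsetᵇ-sound (d ∷ D) block D⊆block)
    , subst (_⊆ (d ∷ D)) (nextBlock≡range k _) (subsetᵇ-sound block (d ∷ D) block⊆D)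

dIsNextBlock-complete : ∀ k d D → IsNextBlock k (d ∷ D) → T (dIsNextBlock k (d ∷ D))
dIsNextBlock-complete k d D (D⊆range , range⊆D) =
  let block≡ = nextBlock≡range k (length (d ∷ D))
  in  Equivalence.from T-∧
        ( subsetᵇ-complete _ (d ∷ D) (subst (_⊆ (d ∷ D)) (sym block≡) range⊆D)
        , subsetᵇ-complete (d ∷ D) _ (subst ((d ∷ D) ⊆_) (sym block≡) D⊆range))

-- Sortable configurations.  A sort can only output 1, 2, ... in order, so a sortable
-- configuration has output 1..k and still holds exactly the entries k+1..n.

Sortable : ℕ → Config → Set
Sortable n c = Star Move c (final n)

remaining : Config → List ℕ
remaining (cfg i d I o) = I ++ d ++ i

emitted : Config → ℕ
emitted c = length (Config.out c)

record Consistent (n : ℕ) (c : Config) : Set where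
  field
    pending    : ℕ
    total      : emitted c + pending ≡ n
    output≡    : Config.out c ≡ idList (emitted c)
    remaining↭ : remaining c ↭ range (emitted c) pending

module _ {n c} (con : Consistent n c) where
  open Consistent con

  remaining-above : ∀ {z} → z ∈ remaining c → emitted c < z
  remaining-above z∈ = proj₁ (∈-range⁻ _ pending (∈-resp-↭ remaining↭ z∈))

  remaining-atMost : ∀ {z} → z ∈ remaining c → z ≤ n
  remaining-atMost z∈ = subst (_ ≤_) total (proj₂ (∈-range⁻ _ pending (∈-resp-↭ remaining↭ z∈)))

  remaining-complete : ∀ {v} → emitted c < v → v ≤ n → v ∈ remaining c
  remaining-complete k<v v≤n =
    ∈-resp-↭ (↭-sym remaining↭) (∈-range⁺ _ pending k<v (subst (_ ≤_) (sym total) v≤n))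

  remaining-unique : Unique (remaining c)
  remaining-unique = unique-resp-↭ (↭-sym remaining↭) (range-unique (emitted c) pending)

consistent-final : ∀ n → Consistent n (final n)
consistent-final n = record
  { pending    = 0
  ; total      = trans (+-identityʳ _) (length-idList n)
  ; output≡    = cong idList (sym (length-idList n))
  ; remaining↭ = ↭-refl }

snoc-idList : ∀ o w → o ∷ʳ w ≡ idList (suc (length o)) → o ≡ idList (length o) × w ≡ suc (length o)
snoc-idList o w e = List.∷ʳ-injective o (idList (length o)) (trans e (idList-∷ʳ (length o)))

emitted-next : ∀ {n i d I o w} → Consistent n (cfg i d I (o ∷ʳ w)) → w ≡ suc (length o)
emitted-next {o = o} {w} con =
  proj₂ (snoc-idList o w (trans (Consistent.output≡ con) (cong idList (length-∷ʳ o w))))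

consistent-↭ : ∀ {n i d I i' d' I' o} → remaining (cfg i d I o) ↭ remaining (cfg i' d' I' o) →
               Consistent n (cfg i' d' I' o) → Consistent n (cfg i d I o)
consistent-↭ rem↭ con = record
  { pending = pending ; total = total ; output≡ = output≡ ; remaining↭ = ↭-trans rem↭ remaining↭ }
  where open Consistent con

-- Consistency propagates backwards along moves: push and dToI only rearrange the
-- remaining entries, and an output move removes the entry k+1.
consistent-back : ∀ {n c c'} → Move c c' → Consistent n c' → Consistent n c
consistent-back (push {x} {i} {d} {I} _) = consistent-↭ (++⁺ˡ I (shift x d i))
consistent-back (dToI {x} {i} {d} {I} _) = consistent-↭ (shift x I (d ++ i))
consistent-back (emit {w} {i} {d} {I} {o}) con = record
  { pending    = suc pending
  ; total      = trans (+-suc (length o) pending) (trans (cong (_+ pending) (sym len)) total)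
  ; output≡    = proj₁ (snoc-idList o w (trans output≡ (cong idList len)))
  ; remaining↭ = subst (λ v → w ∷ remaining (cfg i d I (o ∷ʳ w)) ↭ v ∷ range (suc (length o)) pending)
                       (emitted-next con) (prep w (subst (λ k → _ ↭ range k pending) len remaining↭)) }
  where
  open Consistent con
  len : length (o ∷ʳ w) ≡ suc (length o)
  len = length-∷ʳ o w

sortable-consistent : ∀ {n c} → Sortable n c → Consistent n c
sortable-consistent {n} ε       = consistent-final n
sortable-consistent (m ◅ σ) = consistent-back m (sortable-consistent σ)

-- Reachable configurations have monotone stacks, since every move checks the top entry.

record Monotone (c : Config) : Set where
  constructor monotone
  field
    D↓ : AllPairs _>_ (Config.D c)
    I↑ : AllPairs _<_ (Config.I c)

top-max : ∀ {t z} {D : List ℕ} → AllPairs _>_ (t ∷ D) → z ∈ t ∷ D → z ≤ t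
top-max _           (here refl) = ≤-refl
top-max (t>D ∷ _) (there z∈)  = <⇒≤ (All.lookup t>D z∈)

top-min : ∀ {t z} {I : List ℕ} → AllPairs _<_ (t ∷ I) → z ∈ t ∷ I → t ≤ z
top-min _           (here refl) = ≤-refl
top-min (t<I ∷ _) (there z∈)  = <⇒≤ (All.lookup t<I z∈)

below-I : ∀ {x z} I → AllPairs _<_ I → CanPushI x I → z ∈ I → x < z
below-I (t ∷ I) I↑ x<t z∈ = <-≤-trans x<t (top-min I↑ z∈)

push-decreasing : ∀ {x} D → CanPushD x D → AllPairs _>_ D → AllPairs _>_ (x ∷ D)
push-decreasing []      _   []            = [] ∷ []
push-decreasing (t ∷ D) t<x D↓@(t>D ∷ _) = (t<x ∷ All.map (λ z<t → <-trans z<t t<x) t>D) ∷ D↓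

push-increasing : ∀ {x} I → CanPushI x I → AllPairs _<_ I → AllPairs _<_ (x ∷ I)
push-increasing []      _   []            = [] ∷ []
push-increasing (t ∷ I) x<t I↑@(t<I ∷ _) = (x<t ∷ All.map (<-trans x<t) t<I) ∷ I↑

monotone-move : ∀ {c c'} → Move c c' → Monotone c → Monotone c'
monotone-move (push {D = D} x-onD) (monotone D↓ I↑)       = monotone (push-decreasing D x-onD D↓) I↑
monotone-move (dToI {I = I} x-onI) (monotone (_ ∷ D↓) I↑) = monotone D↓ (push-increasing I x-onI I↑)
monotone-move emit              (monotone D↓ (_ ∷ I↑)) = monotone D↓ I↑

monotone-star : ∀ {c c'} → Star Move c c' → Monotone c → Monotone c'
monotone-star ε       mon = mon
monotone-star (m ◅ s) mon = monotone-star s (monotone-move m mon)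

-- Jams: configurations that look unfinished but can never be sorted.  They are the
-- obstruction met by any first move other than the algorithm's.

data Precedes (x v : ℕ) : List ℕ → Set where
  first : ∀ {l} → v ∈ l → Precedes x v (x ∷ l)
  later : ∀ {w l} → Precedes x v l → Precedes x v (w ∷ l)

precedes-∈ : ∀ {x v l} → Precedes x v l → v ∈ l
precedes-∈ (first v∈) = there v∈
precedes-∈ (later p)  = there (precedes-∈ p)

-- v cannot leave the input and D before x does: v follows x in the input, or x is in D and
-- v is in D (below x, when D is monotone and v < x) or still unread.
Behind : ℕ → ℕ → List ℕ → List ℕ → Set
Behind x v i d = Precedes x v i ⊎ (x ∈ d × v ∈ d ++ i)

behind-∈ : ∀ {x v i d} → Behind x v i d → v ∈ d ++ i
behind-∈ {d = d} (inj₁ p)        = ∈-++⁺ʳ d (precedes-∈ p)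
behind-∈         (inj₂ (_ , v∈)) = v∈

-- A jam: an entry a on I, a smaller entry v and a larger entry x with v behind x.
-- Then a must be output before x can enter I, v before a, and v can only come after x.
data Jammed : Config → Set where
  jam : ∀ {i d I o a v x} → a ∈ I → v < a → a < x → Behind x v i d → Jammed (cfg i d I o)

∈-push : ∀ {v w} (d i : List ℕ) → v ∈ d ++ w ∷ i → v ∈ (w ∷ d) ++ i
∈-push d i v∈ with ∈-++⁻ d v∈
... | inj₁ v∈d         = there (∈-++⁺ˡ v∈d)
... | inj₂ (here refl) = here refl
... | inj₂ (there v∈i) = there (∈-++⁺ʳ d v∈i)

jammed-step : ∀ {n c c'} → Monotone c → Consistent n c' → Move c c' → Jammed c → Jammed c'
jammed-step _ _ (push {D = d} _) (jam a∈ v<a a<x (inj₁ (first v∈))) =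
  jam a∈ v<a a<x (inj₂ (here refl , there (∈-++⁺ʳ d v∈)))
jammed-step _ _ (push _) (jam a∈ v<a a<x (inj₁ (later p))) = jam a∈ v<a a<x (inj₁ p)
jammed-step _ _ (push {inp = i} {D = d} _) (jam a∈ v<a a<x (inj₂ (x∈ , v∈))) =
  jam a∈ v<a a<x (inj₂ (there x∈ , ∈-push d i v∈))
jammed-step _ _ (dToI _) (jam a∈ v<a a<x (inj₁ p)) = jam (there a∈) v<a a<x (inj₁ p)
jammed-step (monotone _ I↑) _ (dToI {I = I} x-onI) (jam a∈ v<a a<x (inj₂ (here refl , _))) =
  ⊥-elim (<-asym a<x (below-I I I↑ x-onI a∈))
jammed-step (monotone (w>d ∷ _) _) _ (dToI _) (jam a∈ v<a a<x (inj₂ (there x∈ , here refl))) =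
  ⊥-elim (<-asym (<-trans v<a a<x) (All.lookup w>d x∈))
jammed-step _ _ (dToI _) (jam a∈ v<a a<x (inj₂ (there x∈ , there v∈))) =
  jam (there a∈) v<a a<x (inj₂ (x∈ , v∈))
jammed-step _ con (emit {w} {I = I} {out = o}) (jam {v = v} (here refl) v<w _ behind) =
  ⊥-elim (<-asym v<w w<v)
  where
  w<v : w < v
  w<v = subst₂ _<_ (sym (emitted-next con)) refl
          (subst (_< v) (length-∷ʳ o w) (remaining-above con (∈-++⁺ʳ I (behind-∈ behind))))
jammed-step _ _ emit (jam (there a∈) v<a a<x behind) = jam a∈ v<a a<x behind

-- The final configuration is not jammed (I is empty), so a jammed configuration is unsortable.
jammed-unsortable : ∀ {n c} → Monotone c → Jammed c → Sortable n c → ⊥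
jammed-unsortable _   (jam () _ _ _) ε
jammed-unsortable mon jammed (m ◅ σ) =
  jammed-unsortable (monotone-move m mon) (jammed-step mon (sortable-consistent σ) m jammed) σ

unique-disjoint : ∀ {x} (xs : List ℕ) {ys} → Unique (xs ++ ys) → x ∈ xs → x ∈ ys → ⊥
unique-disjoint (_ ∷ xs) (x∉ ∷ _) (here refl) x∈ys = All.lookup x∉ (∈-++⁺ʳ xs x∈ys) refl
unique-disjoint (_ ∷ xs) (_ ∷ u)  (there x∈)  x∈ys = unique-disjoint xs u x∈ x∈ys

unique-suffix : ∀ (xs : List ℕ) {ys} → Unique (xs ++ ys) → Unique ys
unique-suffix []       u       = u
unique-suffix (_ ∷ xs) (_ ∷ u) = unique-suffix xs u

NextOnTop : ℕ → List ℕ → Set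
NextOnTop k []      = ⊥
NextOnTop k (t ∷ _) = t ≡ suc k

Pushable : List ℕ → List ℕ → List ℕ → Set
Pushable []      D I = ⊥
Pushable (x ∷ _) D I = CanPushI x I × CanPushD x D

output-needs-next : ∀ {n i d w I o} → ¬ NextOnTop (length o) (w ∷ I) →
                    Sortable n (cfg i d I (o ∷ʳ w)) → ⊥
output-needs-next ¬next σ = ¬next (emitted-next (sortable-consistent σ))

record SafeStep (n : ℕ) (c : Config) (r : Maybe Config) : Set where
  constructor safe
  field
    {mid next} : Config
    returns    : r ≡ just next
    first-move : Move c mid
    more-moves : Star Move mid next
    sortable   : Sortable n next

-- Rule (1): with k+1 on top of I, some sort starts by outputting it.  Pushes commute with
-- the output move, and moving the top x of D onto I first is impossible as k < x < k+1.
output-first : ∀ {n i d I o t} → t ≡ suc (length o) →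
               Sortable n (cfg i d (t ∷ I) o) → Sortable n (cfg i d I (o ∷ʳ t))
output-first _   (emit ◅ σ)   = σ
output-first t≡ (push p ◅ σ) = push p ◅ output-first t≡ σ
output-first {I = I} {t = t} t≡ σ@(dToI x<t ◅ _) =
  ⊥-elim (<⇒≱ (remaining-above (sortable-consistent σ) (∈-++⁺ʳ (t ∷ I) (here refl)))
               (≤-pred (subst (_ <_) t≡ x<t)))

moveAll-succeeds : ∀ D I → AllPairs _>_ D → (∀ {z} → z ∈ D → CanPushI z I) →
                   moveAll D I ≡ just (D ʳ++ I)
moveAll-succeeds []      I _           _      = refl
moveAll-succeeds (x ∷ D) I (x>D ∷ D↓) D-onto-I rewrite canPushIᵇ-complete I (D-onto-I (here refl)) =
  moveAll-succeeds D (x ∷ I) D↓ (All.lookup x>D)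

moveAll-moves : ∀ {i o} D I → AllPairs _>_ D → (∀ {z} → z ∈ D → CanPushI z I) →
                Star Move (cfg i D I o) (cfg i [] (D ʳ++ I) o)
moveAll-moves []      I _           _    = ε
moveAll-moves (x ∷ D) I (x>D ∷ D↓) D-onto-I =
  dToI (D-onto-I (here refl)) ◅ moveAll-moves D (x ∷ I) D↓ (All.lookup x>D)

reverse-block : ∀ k D (I : List ℕ) → AllPairs _>_ D → IsNextBlock k D →
                D ʳ++ I ≡ range k (length D) ++ I
reverse-block k []      I _           _                   = refl
reverse-block k (x ∷ D) I (x>D ∷ D↓) (D⊆range , range⊆D) = begin
  D ʳ++ x ∷ I                       ≡⟨ reverse-block k D (x ∷ I) D↓ (D⊆range′ , range⊆D′) ⟩
  range k m ++ x ∷ I                ≡⟨ cong (λ y → range k m ++ y ∷ I) x≡max ⟩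
  range k m ++ [ k + suc m ] ++ I   ≡⟨ List.++-assoc (range k m) _ I ⟨
  (range k m ∷ʳ (k + suc m)) ++ I   ≡⟨ cong (_++ I) (range-∷ʳ k m) ⟨
  range k (suc m) ++ I              ∎
  where
  open ≡-Reasoning
  m = length D
  x≡max : x ≡ k + suc m
  x≡max with range⊆D (∈-range⁺ k (suc m) (m<m+n k z<s) ≤-refl)
  ... | here max≡x = sym max≡x
  ... | there max∈D = ⊥-elim (<⇒≱ (All.lookup x>D max∈D) (proj₂ (∈-range⁻ k (suc m) (D⊆range (here refl)))))
  D⊆range′ : D ⊆ range k m
  D⊆range′ {z} z∈ = ∈-range⁺ k m (proj₁ (∈-range⁻ k (suc m) (D⊆range (there z∈))))
                      (≤-pred (subst (z <_) (trans x≡max (+-suc k m)) (All.lookup x>D z∈)))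
  range⊆D′ : range k m ⊆ D
  range⊆D′ {v} v∈ with ∈-range⁻ k m v∈
  ... | k<v , v≤k+m with range⊆D (∈-range⁺ k (suc m) k<v (≤-trans v≤k+m (+-monoʳ-≤ k (n≤1+n m))))
  ...   | here v≡x  = ⊥-elim (<-irrefl (trans v≡x x≡max) (≤-<-trans v≤k+m (+-monoʳ-< k (n<1+n m))))
  ...   | there v∈D = v∈D

emit-range : ∀ {i D I} k m → Star Move (cfg i D (range k m ++ I) (idList k)) (cfg i D I (idList (k + m)))
emit-range {i} {D} {I} k zero =
  subst (λ j → Star Move (cfg i D I (idList k)) (cfg i D I (idList j))) (sym (+-identityʳ k)) ε
emit-range {i} {D} {I} k (suc m) =
  emit ◅ subst₂ (λ o j → Star Move (cfg i D (range (suc k) m ++ I) o) (cfg i D I (idList j)))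
                (idList-∷ʳ k) (sym (+-suc k m)) (emit-range (suc k) m)

canPushD-prefix : ∀ {x} Dn Db → CanPushD x (Dn ++ Db) → CanPushD x Dn
canPushD-prefix []      Db _  = tt
canPushD-prefix (_ ∷ _) Db t<x = t<x

-- The entries ≤ B still to be output sit at the bottom (Db) of D and at the top (Ib) of I;
-- all other entries on the stacks (Dn, In) and in the input exceed B.
record BlockSplit (B : ℕ) (c : Config) (Dn Db Ib In : List ℕ) : Set where
  constructor split
  field
    D≡      : Config.D c ≡ Dn ++ Db
    I≡      : Config.I c ≡ Ib ++ In
    input>B : All (B <_) (Config.inp c)
    Dn>B    : All (B <_) Dn
    In>B    : All (B <_) In
    Db≤B    : All (_≤ B) Db
    Ib≤B    : All (_≤ B) Ib

block-output : ∀ {n B i d I o Dn Db Ib In} → Consistent n (cfg i d I o) → length o ≡ B →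
               BlockSplit B (cfg i d I o) Dn Db Ib In → cfg i d I o ≡ cfg i Dn In (idList B)
block-output {B = B} {i} {d} {I} {o} {Dn} {Db} {Ib} {In} con k≡B (split D≡ I≡ _ _ _ Db≤B Ib≤B) =
  trans (cong₂ (λ d′ I′ → cfg i d′ I′ o)
               (trans D≡ (trans (cong (Dn ++_) Db≡[]) (List.++-identityʳ Dn)))
               (trans I≡ (cong (_++ In) Ib≡[])))
        (cong (cfg i Dn In) (trans (Consistent.output≡ con) (cong idList k≡B)))
  where
  empty : ∀ xs → All (_≤ B) xs → (∀ {z} → z ∈ xs → z ∈ remaining (cfg i d I o)) → xs ≡ []
  empty []      _           _    = refl
  empty (x ∷ _) (x≤B ∷ _) ⊆rem =
    ⊥-elim (<⇒≱ (subst (_< x) k≡B (remaining-above con (⊆rem (here refl)))) x≤B)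
  Db≡[] : Db ≡ []
  Db≡[] = empty Db Db≤B (λ z∈ → ∈-++⁺ʳ I (∈-++⁺ˡ (subst (_ ∈_) (sym D≡) (∈-++⁺ʳ Dn z∈))))
  Ib≡[] : Ib ≡ []
  Ib≡[] = empty Ib Ib≤B (λ z∈ → ∈-++⁺ˡ (subst (_ ∈_) (sym I≡) (∈-++⁺ˡ z∈)))

-- Exchange argument behind rule (2): if every entry ≤ B still to be output is already on the
-- stacks, as in a block split, then outputting these first loses nothing — deleting them and
-- outputting 1..B leaves a sortable configuration.  Each move of a sort of c is replayed on
-- the configuration without the block until the block has been output; a move that would
-- interleave a large entry with the block is illegal.
block-first : ∀ {n B c Dn Db Ib In} → B ≤ n → emitted c ≤ B → BlockSplit B c Dn Db Ib In →
              Sortable n c → Sortable n (cfg (Config.inp c) Dn In (idList B))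
-- The same when 1..B has not all been output yet, by cases on the first move: a push
-- (of an entry above B) is replayed; moving a block entry onto I or outputting it keeps a
-- block split; a large entry moves onto In (replayed) but not onto a block entry; and an
-- entry of In cannot be output while k+1 ≤ B is still pending.
block-first-move : ∀ {n B c Dn Db Ib In} → B ≤ n → emitted c < B → BlockSplit B c Dn Db Ib In →
                   Sortable n c → Sortable n (cfg (Config.inp c) Dn In (idList B))

block-first {c = cfg i d I o} B≤n k≤B s σ with length o <? _
... | yes k<B = block-first-move B≤n k<B s σ
... | no  k≮B = subst (Sortable _) (block-output (sortable-consistent σ) (≤-antisym k≤B (≮⇒≥ k≮B)) s) σ

block-first-move {n} B≤n k<B _ ε = ⊥-elim (<⇒≱ k<B (subst (_ ≤_) (sym (length-idList n)) B≤n))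
block-first-move {Dn = Dn} {Db} B≤n k<B (split D≡ I≡ (x>B ∷ i>B) Dn>B In>B Db≤B Ib≤B)
                 (push {x} x-onD ◅ σ) =
  push (canPushD-prefix Dn Db (subst (CanPushD x) D≡ x-onD))
  ◅ block-first B≤n (<⇒≤ k<B) (split (cong (x ∷_) D≡) I≡ i>B (x>B ∷ Dn>B) In>B Db≤B Ib≤B) σ
block-first-move {Dn = []} B≤n k<B (split refl I≡ i>B [] In>B (w≤B ∷ Db≤B) Ib≤B) (dToI {w} _ ◅ σ) =
  block-first B≤n (<⇒≤ k<B) (split refl (cong (w ∷_) I≡) i>B [] In>B Db≤B (w≤B ∷ Ib≤B)) σ
block-first-move {Dn = _ ∷ _} {Ib = _ ∷ _} _ _ (split refl refl _ (w>B ∷ _) _ _ (b≤B ∷ _))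
                 (dToI w<b ◅ _) =
  ⊥-elim (<-asym w<b (≤-<-trans b≤B w>B))
block-first-move {Dn = _ ∷ _} {Ib = []} B≤n k<B (split refl refl i>B (w>B ∷ Dn>B) In>B Db≤B [])
                 (dToI w-onI ◅ σ) =
  dToI w-onI ◅ block-first B≤n (<⇒≤ k<B) (split refl refl i>B Dn>B (w>B ∷ In>B) Db≤B []) σ
block-first-move {Ib = []} _ k<B (split _ refl _ _ (w>B ∷ _) _ []) (emit ◅ σ) =
  ⊥-elim (<⇒≱ w>B (subst (_≤ _) (sym (emitted-next (sortable-consistent σ))) k<B))
block-first-move {B = B} {Ib = _ ∷ _} B≤n k<B (split D≡ refl i>B Dn>B In>B Db≤B (_ ∷ Ib≤B))
                 (emit {w} {out = o} ◅ σ) =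
  block-first B≤n (subst (_≤ B) (sym (length-∷ʳ o w)) k<B) (split D≡ refl i>B Dn>B In>B Db≤B Ib≤B) σ

module _ {n i D I o} (con : Consistent n (cfg i D I o)) (block : IsNextBlock (length o) D) where

  private
    B = length o + length D

  outside-block : ∀ {z} → z ∈ remaining (cfg i D I o) → z ∉ D → B < z
  outside-block z∈ z∉D with _ ≤? B
  ... | no  z≰B = ≰⇒> z≰B
  ... | yes z≤B = ⊥-elim (z∉D (proj₂ block (∈-range⁺ _ _ (remaining-above con z∈) z≤B)))

  I-above-block : All (B <_) I
  I-above-block = All.tabulate λ z∈I →
    outside-block (∈-++⁺ˡ z∈I) (unique-disjoint I (remaining-unique con) z∈I ∘′ ∈-++⁺ˡ)

  input-above-block : All (B <_) i
  input-above-block = All.tabulate λ z∈i →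
    outside-block (∈-++⁺ʳ I (∈-++⁺ʳ D z∈i))
                  (λ z∈D → unique-disjoint D (unique-suffix I (remaining-unique con)) z∈D z∈i)

  block-below : All (_≤ B) D
  block-below = All.tabulate λ z∈D → proj₂ (∈-range⁻ _ _ (proj₁ block z∈D))

  block-onto-I : ∀ {z} → z ∈ D → CanPushI z I
  block-onto-I {z} z∈D = below I-above-block
    where
    below : ∀ {J} → All (B <_) J → CanPushI z J
    below []        = tt
    below (B<t ∷ _) = ≤-<-trans (All.lookup block-below z∈D) B<t

-- Rule (2) is safe: if D is the next block k+1..B, moving it onto I succeeds, is legal and
-- puts k+1, ..., B in order on top of I; outputting them reaches the configuration that
-- block-first shows sortable.
block-move-safe : ∀ {n i d1 d I o} → Monotone (cfg i (d1 ∷ d) I o) → IsNextBlock (length o) (d1 ∷ d) →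
                  Sortable n (cfg i (d1 ∷ d) I o) →
                  moveAll (d1 ∷ d) I ≡ just ((d1 ∷ d) ʳ++ I) ×
                  SafeStep n (cfg i (d1 ∷ d) I o) (just (cfg i [] ((d1 ∷ d) ʳ++ I) o))
block-move-safe {n} {i} {d1} {d} {I} {o} (monotone D↓@(d1>d ∷ d↓) _) block σ =
  moveAll-succeeds D I D↓ (block-onto-I con block) ,
  safe refl (dToI (block-onto-I con block (here refl)))
            (moveAll-moves d (d1 ∷ I) d↓ (All.lookup d1>d))
            (subst (λ J → Sortable n (cfg i [] J o)) (sym (reverse-block k D I D↓ block))
                   (subst (λ o′ → Star Move (cfg i [] (range k m ++ I) o′) (cfg i [] I (idList (k + m))))
                          (sym (Consistent.output≡ con))
                          (emit-range k m)
                    ◅◅ block-first B≤n (m≤m+n k m)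
                         (split refl refl (input-above-block con block) [] (I-above-block con block)
                                (block-below con block) [])
                         σ))
  where
  D = d1 ∷ d
  k = length o
  m = length D
  con = sortable-consistent σ
  B≤n : k + m ≤ n
  B≤n = remaining-atMost con (∈-++⁺ʳ I (∈-++⁺ˡ (proj₂ block (∈-range⁺ k m (m<m+n k z<s) ≤-refl))))

-- Rules (3) and (4): a sort that deviates from the algorithm's move jams.

cover-or-gap : ∀ k t xs → k ≤ t →
               (∀ {v} → k < v → v ≤ t → v ∈ xs) ⊎ ∃[ v ] (k < v × v ≤ t × v ∉ xs)
cover-or-gap k t xs k≤t with all? (_∈? xs) (range k (t ∸ k))
... | yes covered = inj₁ λ k<v v≤t →
  All.lookup covered (∈-range⁺ k (t ∸ k) k<v (subst (_ ≤_) (sym (m+[n∸m]≡n k≤t)) v≤t))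
... | no ¬covered with find (¬All⇒Any¬ (_∈? xs) _ ¬covered)
...   | v , v∈range , v∉xs =
  let k<v , v≤ = ∈-range⁻ k (t ∸ k) v∈range in inj₂ (v , k<v , subst (v ≤_) (m+[n∸m]≡n k≤t) v≤ , v∉xs)

-- A decreasing list of entries above k, with top t, that contains all of (k, t] has exactly
-- t - k entries: going down, each entry must be the predecessor of the one above.
covering-length : ∀ k t D → AllPairs _>_ (t ∷ D) → All (k <_) (t ∷ D) →
                  (∀ {v} → k < v → v ≤ t → v ∈ t ∷ D) → k + length (t ∷ D) ≡ t
covering-length k t       []      _                  (k<t ∷ _)   covers with covers ≤-refl k<t
... | here k+1≡t = trans (+-comm k 1) k+1≡t
covering-length k zero    (y ∷ D) ((() ∷ _) ∷ _)    _           _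
covering-length k (suc p) (y ∷ D) ((y<t ∷ _) ∷ D↓) (_ ∷ above) covers =
  trans (+-suc k _) (cong suc (trans (covering-length k y D D↓ above covers′) y≡p))
  where
  y≤p : y ≤ p
  y≤p = ≤-pred y<t
  y≡p : y ≡ p
  y≡p with covers (<-≤-trans (All.head above) y≤p) (n≤1+n p)
  ... | here p≡1+p = ⊥-elim (<-irrefl p≡1+p (n<1+n p))
  ... | there p∈   = ≤-antisym y≤p (top-max D↓ p∈)
  covers′ : ∀ {v} → k < v → v ≤ y → v ∈ y ∷ D
  covers′ k<v v≤y with covers k<v (≤-trans v≤y (<⇒≤ y<t))
  ... | here v≡t = ⊥-elim (<-irrefl v≡t (≤-<-trans v≤y y<t))
  ... | there v∈ = v∈

block-or-gap : ∀ k t D → AllPairs _>_ (t ∷ D) → All (k <_) (t ∷ D) →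
               IsNextBlock k (t ∷ D) ⊎ ∃[ v ] (k < v × v < t × v ∉ t ∷ D)
block-or-gap k t D D↓ above with cover-or-gap k t (t ∷ D) (<⇒≤ (All.head above))
... | inj₂ (v , k<v , v≤t , v∉) = inj₂ (v , k<v , ≤∧≢⇒< v≤t (λ v≡t → v∉ (here v≡t)) , v∉)
... | inj₁ covers = inj₁ (D⊆range , range⊆D)
  where
  length≡ : k + length (t ∷ D) ≡ t
  length≡ = covering-length k t D D↓ above covers
  D⊆range : t ∷ D ⊆ range k (length (t ∷ D))
  D⊆range z∈ = ∈-range⁺ k _ (All.lookup above z∈) (subst (_ ≤_) (sym length≡) (top-max D↓ z∈))
  range⊆D : range k (length (t ∷ D)) ⊆ t ∷ D
  range⊆D v∈ = let k<v , v≤ = ∈-range⁻ k _ v∈ in covers k<v (subst (_ ≤_) length≡ v≤)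

-- Pushing x while the top t of I is at most x and is not k+1 jams: t < x as entries are
-- distinct, and k+1 > t is not on I, so it is behind x.
push-jams : ∀ {n x i d t I o} → Monotone (cfg (x ∷ i) d (t ∷ I) o) →
            Consistent n (cfg (x ∷ i) d (t ∷ I) o) → t ≢ suc (length o) → ¬ x < t → Jammed (cfg i (x ∷ d) (t ∷ I) o)
push-jams {x = x} {i} {d} {t} {I} {o} (monotone _ I↑) con t≢k+1 x≮t =
  jam (here refl) k+1<t t<x (inj₂ (here refl , k+1-behind))
  where
  k = length o
  t<x : t < x
  t<x = ≤∧≢⇒< (≮⇒≥ x≮t)
          (λ t≡x → unique-disjoint (t ∷ I) (remaining-unique con) (here refl) (∈-++⁺ʳ d (here t≡x)))
  k+1<t : suc k < t
  k+1<t = ≤∧≢⇒< (remaining-above con (here refl)) (t≢k+1 ∘′ sym)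
  k+1-behind : suc k ∈ (x ∷ d) ++ i
  k+1-behind with ∈-++⁻ (t ∷ I) (remaining-complete con ≤-refl
                                   (≤-trans (<⇒≤ k+1<t) (remaining-atMost con (here refl))))
  ... | inj₁ on-I    = ⊥-elim (<⇒≱ k+1<t (top-min I↑ on-I))
  ... | inj₂ in-rest = ∈-push d i in-rest

-- Moving the top d1 of D onto I jams when x, the next input entry, could go onto D and onto I
-- and D is not the next block: some v < d1 is missing from D, and v is not on I (whose
-- entries exceed x > d1), so v follows x in the input.
move-top-jams : ∀ {n x i d1 d I o} → Monotone (cfg (x ∷ i) (d1 ∷ d) I o) →
                Consistent n (cfg (x ∷ i) (d1 ∷ d) I o) → ¬ IsNextBlock (length o) (d1 ∷ d) →
                CanPushI x I → d1 < x → Jammed (cfg (x ∷ i) d (d1 ∷ I) o)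
move-top-jams {x = x} {i} {d1} {d} {I} {o} (monotone D↓ I↑) con ¬block x-onI d1<x
  with block-or-gap (length o) d1 d D↓ (All.tabulate (λ z∈ → remaining-above con (∈-++⁺ʳ I (∈-++⁺ˡ z∈))))
... | inj₁ block                  = ⊥-elim (¬block block)
... | inj₂ (v , k<v , v<d1 , v∉D) = jam (here refl) v<d1 d1<x (inj₁ (first v∈i))
  where
  v∈i : v ∈ i
  v∈i with ∈-++⁻ I (remaining-complete con k<v
                       (≤-trans (<⇒≤ v<d1) (remaining-atMost con (∈-++⁺ʳ I (here refl)))))
  ... | inj₁ v∈I = ⊥-elim (<-asym (<-trans v<d1 d1<x) (below-I I I↑ x-onI v∈I))
  ... | inj₂ v∈rest with ∈-++⁻ (d1 ∷ d) v∈rest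
  ...   | inj₁ v∈D         = ⊥-elim (v∉D v∈D)
  ...   | inj₂ (here v≡x)  = ⊥-elim (<-asym (subst (_< d1) v≡x v<d1) d1<x)
  ...   | inj₂ (there v∈i) = v∈i

-- Rule (3) is safe: if x may be pushed, k+1 is not on top of I and D is not the next block,
-- a sort cannot start with an output, and starting with a move of the top of D jams.
push-safe : ∀ {n x i d I o c₁} → Monotone (cfg (x ∷ i) d I o) → ¬ NextOnTop (length o) I →
            dIsNextBlock (length o) d ≡ false → CanPushI x I → CanPushD x d →
            Move (cfg (x ∷ i) d I o) c₁ → Sortable n c₁ → Sortable n (cfg i (x ∷ d) I o)
push-safe _ _     _ _ _ (push _) σ = σ
push-safe _ ¬next _ _ _ emit     σ = ⊥-elim (output-needs-next ¬next σ)
push-safe {d = d1 ∷ d} mon _ ¬block x-onI d1<x (dToI d1-onI) σ =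
  ⊥-elim (jammed-unsortable (monotone-move (dToI d1-onI) mon)
            (move-top-jams mon (consistent-back (dToI d1-onI) (sortable-consistent σ))
                           (λ block → subst T ¬block (dIsNextBlock-complete _ d1 d block)) x-onI d1<x)
            σ)

-- Rule (4) is safe when neither rule (1) nor rule (3) applies: a sort cannot start with an
-- output, nor (by push-jams) with a push; so it starts with the move of rule (4).
rule4-safe : ∀ {n i d I o c₁} → Monotone (cfg i d I o) → ¬ NextOnTop (length o) I → ¬ Pushable i d I →
             Move (cfg i d I o) c₁ → Sortable n c₁ → SafeStep n (cfg i d I o) (rule4 i d I o)
rule4-safe _ ¬next _ emit σ = ⊥-elim (output-needs-next ¬next σ)
rule4-safe {I = I} _ _ _ (dToI x-onI) σ rewrite canPushIᵇ-complete I x-onI = safe refl (dToI x-onI) ε σ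
rule4-safe {I = []}    _   _     ¬push (push x-onD) _ = ⊥-elim (¬push (tt , x-onD))
rule4-safe {I = t ∷ I} mon ¬next ¬push (push x-onD) σ =
  ⊥-elim (jammed-unsortable (monotone-move (push x-onD) mon)
            (push-jams mon (consistent-back (push x-onD) (sortable-consistent σ)) ¬next
                       (λ x<t → ¬push (x<t , x-onD)))
            σ)

rule3-safe : ∀ {n i d I o c₁} → Monotone (cfg i d I o) → ¬ NextOnTop (length o) I →
             dIsNextBlock (length o) d ≡ false →
             Move (cfg i d I o) c₁ → Sortable n c₁ → SafeStep n (cfg i d I o) (rule3 i d I o)
rule3-safe {i = []} mon ¬next _ m σ = rule4-safe mon ¬next (λ ()) m σ
rule3-safe {i = x ∷ i} {d} {I} mon ¬next ¬block m σ with canPushIᵇ x I ∧ canPushDᵇ x d in pushable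
... | true  = safe refl (push x-onD) ε (push-safe mon ¬next ¬block x-onI x-onD m σ)
  where
  x-onI : CanPushI x I
  x-onI = canPushIᵇ-sound I (∧-conicalˡ _ _ pushable)
  x-onD : CanPushD x d
  x-onD = canPushDᵇ-sound d (∧-conicalʳ (canPushIᵇ x I) _ pushable)
... | false = rule4-safe mon ¬next ¬push m σ
  where
  ¬push : ¬ Pushable (x ∷ i) d I
  ¬push (x-onI , x-onD)
    with trans (sym pushable) (cong₂ _∧_ (canPushIᵇ-complete I x-onI) (canPushDᵇ-complete d x-onD))
  ... | ()

rule2-safe : ∀ {n i d I o c₁} → Monotone (cfg i d I o) → ¬ NextOnTop (length o) I →
             Move (cfg i d I o) c₁ → Sortable n c₁ → SafeStep n (cfg i d I o) (rule2 i d I o)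
rule2-safe {d = []} mon ¬next m σ = rule3-safe mon ¬next refl m σ
rule2-safe {d = d1 ∷ d} {I = I} {o = o} mon ¬next m σ with dIsNextBlock (length o) (d1 ∷ d) in isBlock
... | false = rule3-safe mon ¬next isBlock m σ
... | true with moveAll (d1 ∷ d) I | block-move-safe mon (dIsNextBlock-sound _ d1 d (true⇒T isBlock)) (m ◅ σ)
...   | just _ | refl , safe-step = safe-step

rule1-safe : ∀ {n i d I o c₁} → Monotone (cfg i d I o) →
             Move (cfg i d I o) c₁ → Sortable n c₁ → SafeStep n (cfg i d I o) (rule1 i d I o)
rule1-safe {I = []} mon m σ = rule2-safe mon (λ ()) m σ
rule1-safe {I = t ∷ I} {o} mon m σ with t ≡ᵇ suc (length o) in next
... | true  = safe refl emit ε (output-first (≡ᵇ⇒≡ t _ (true⇒T next)) (m ◅ σ))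
... | false = rule2-safe mon ¬next m σ
  where
  ¬next : ¬ NextOnTop (length o) (t ∷ I)
  ¬next t≡k+1 = subst T next (≡⇒≡ᵇ t _ t≡k+1)

-- The number of moves still needed: three for each unread entry, two for each entry of D,
-- one for each entry of I.  Every move lowers it by one.
movesLeft : Config → ℕ
movesLeft (cfg i d I o) = 3 * length i + 2 * length d + length I

movesLeft-move : ∀ {c c'} → Move c c' → movesLeft c ≡ suc (movesLeft c')
movesLeft-move (push {inp = i} {D = d} {I = I} _) = count (length i) (length d) (length I)
  where
  count : ∀ a b c → 3 * suc a + 2 * b + c ≡ suc (3 * a + 2 * suc b + c)
  count = solve-∀
movesLeft-move (dToI {inp = i} {D = d} {I = I} _) = count (length i) (length d) (length I)
  where
  count : ∀ a b c → 3 * a + 2 * suc b + c ≡ suc (3 * a + 2 * b + suc c)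
  count = solve-∀
movesLeft-move (emit {inp = i} {D = d} {I = I}) = +-suc (3 * length i + 2 * length d) (length I)

movesLeft-star : ∀ {c c'} → Star Move c c' → movesLeft c' ≤ movesLeft c
movesLeft-star ε           = ≤-refl
movesLeft-star (m ◅ moves) =
  ≤-trans (movesLeft-star moves) (≤-trans (n≤1+n _) (≤-reflexive (sym (movesLeft-move m))))

-- From a monotone sortable configuration the algorithm runs to the end of the sort: each
-- step is safe, so the invariants persist, and it strictly lowers the moves left.
algorithm-sorts : ∀ {n} c → Acc _<_ (movesLeft c) → Monotone c → Sortable n c → Star AlgStep c (final n)
algorithm-sorts _ _ _ ε = ε
algorithm-sorts c@(cfg _ _ _ _) (acc smaller) mon (m ◅ σ) with rule1-safe mon m σ
... | safe {next = next} returns first-move more-moves sortable =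
  returns ◅ algorithm-sorts next (smaller fewer)
                            (monotone-star more-moves (monotone-move first-move mon)) sortable
  where
  fewer : movesLeft next < movesLeft c
  fewer = ≤-<-trans (movesLeft-star more-moves) (≤-reflexive (sym (movesLeft-move first-move)))

-- The initial configuration has empty, hence monotone, stacks.
proposition3 : (π : List ℕ) → IsPerm π → DISortable π → AlgSorts π
proposition3 π _ sortable = algorithm-sorts (initial π) (<-wellFounded _) (monotone [] []) sortable
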